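{- Let $\lambda_1$ and $n$ be positive integers. Suppose $(\mathcal{V},\mathcal{B})$ is a $\mathrm{DK}(\lambda_1 n,\lambda_1^2)$-design with $|\mathcal{V}|=k$, say $\mathcal{V}=\{1,\dots,k\}$, and $|\mathcal{B}|=n^2$, together with two orthogonal equipartitions $\mathcal{P}_1=\{R_1,\dots,R_n\}$ and $\mathcal{P}_2=\{C_1,\dots,C_n\}$ of $\mathcal{B}$, each of type $n^n$. For $1\le i,j\le n$ let $B_{i,j}$ be the unique block in $R_i\cap C_j$, and for $1\le x\le k$ let $F_x$ be the $n\times n$ $(0,1)$-matrix whose cell $(i,j)$ is $1$ if and only if $x\in B_{i,j}$. Then $\{F_1,\dots,F_k\}$ is a set of $k$ mutually orthogonal binary frequency squares of type $(n;n-\lambda_1,\lambda_1)$.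
   Context: A design is a pair $(\mathcal{V},\mathcal{B})$ with $\mathcal{V}$ a finite set of points and $\mathcal{B}$ a collection (multiset; repeated and empty blocks allowed) of subsets of $\mathcal{V}$. For positive integers $R,\Lambda$, a $\mathrm{DK}(R,\Lambda)$-design is a design in which every pair of distinct points occurs in exactly $\Lambda$ blocks, every point occurs in exactly $R$ blocks, and $R^2=\Lambda|\mathcal{B}|$. A partition of $\mathcal{B}$ (blocks counted with multiplicity) is an equipartition if each point occurs the same number of times among the blocks of each part (here this forces each point to occur $\lambda_1$ times in each part). Two partitions $\mathcal{P}_1,\mathcal{P}_2$ of $\mathcal{B}$ are orthogonal if $|P_1\cap P_2|\le1$ for all parts $P_1\in\mathcal{P}_1,P_2\in\mathcal{P}_2$; type $n^n$ means $n$ parts each of cardinality $n$. Under these hypotheses each $R_i\cap C_j$ contains exactly one block. A binary frequency square of type $(n;\lambda_0,\lambda_1)$ is an $n\times n$ $(0,1)$-matrix with $\lambda_0$ zeros and $\lambda_1$ ones in each row and column; two such squares are orthogonal if exactly $\lambda_1^2$ cells contain $1$ in both; mutually orthogonal means pairwise orthogonal. -}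

module Defs where

open import Data.Nat using (ℕ; zero; suc; _+_; _*_; _^_; _≤_)
open import Data.Bool using (Bool; true; false; _∧_; if_then_else_; not)
open import Data.Fin using (Fin; zero; suc; _≟_)
open import Relation.Nullary.Decidable using (⌊_⌋)
open import Relation.Nullary using (¬_)
open import Data.Product using (_×_)
open import Relation.Binary.PropositionalEquality using (_≡_)

count : ∀ {m} → (Fin m → Bool) → ℕ
count {zero}  p = 0
count {suc m} p = (if p zero then 1 else 0) + count (λ i → p (suc i))

sumFin : ∀ m → (Fin m → ℕ) → ℕ
sumFin zero    f = 0
sumFin (suc m) f = f zero + sumFin m (λ i → f (suc i))

_==_ : ∀ {n} → Fin n → Fin n → Bool
i == j = ⌊ i ≟ j ⌋

-- A design with point set Fin k and a multiset of m blocks, given as an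
-- indexed family of blocks  B : Fin m → (Fin k → Bool)  (block b contains
-- point x iff B b x ≡ true); repeated and empty blocks are allowed.
Design : ℕ → ℕ → Set
Design k m = Fin m → Fin k → Bool

-- DK(R, Λ)-design (R, Λ positive is a hypothesis of the theorem)
record IsDK {k m : ℕ} (R Λ : ℕ) (B : Design k m) : Set where
  field
    pairs : ∀ (x y : Fin k) → ¬ (x ≡ y) → count (λ b → B b x ∧ B b y) ≡ Λ
    reps  : ∀ (x : Fin k) → count (λ b → B b x) ≡ R
    R²≡Λb : R ^ 2 ≡ Λ * m

Partition : ℕ → ℕ → Set
Partition m n = Fin m → Fin n

partSize : ∀ {m n} → Partition m n → Fin n → ℕ
partSize P i = count (λ b → P b == i)

HasTypeNN : ∀ {m n} → Partition m n → Set
HasTypeNN {n = n} P = ∀ i → partSize P i ≡ n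

IsEquipartition : ∀ {k m n} → Design k m → Partition m n → Set
IsEquipartition B P =
  ∀ x i j → count (λ b → (P b == i) ∧ B b x) ≡ count (λ b → (P b == j) ∧ B b x)

Orthogonal : ∀ {m n₁ n₂} → Partition m n₁ → Partition m n₂ → Set
Orthogonal P Q = ∀ i j → count (λ b → (P b == i) ∧ (Q b == j)) ≤ 1

Square : ℕ → Set
Square n = Fin n → Fin n → Bool

record IsBFS {n : ℕ} (λ0 λ1 : ℕ) (F : Square n) : Set where
  field
    rowOnes  : ∀ i → count (λ j → F i j) ≡ λ1
    rowZeros : ∀ i → count (λ j → not (F i j)) ≡ λ0
    colOnes  : ∀ j → count (λ i → F i j) ≡ λ1
    colZeros : ∀ j → count (λ i → not (F i j)) ≡ λ0

bothOnes : ∀ {n} → Square n → Square n → ℕ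
bothOnes {n} F G = sumFin n (λ i → count (λ j → F i j ∧ G i j))

OrthogonalBFS : ∀ {n} (λ1 : ℕ) → Square n → Square n → Set
OrthogonalBFS λ1 F G = bothOnes F G ≡ λ1 * λ1

IsMOBFS : ∀ {k n} (λ0 λ1 : ℕ) → (Fin k → Square n) → Set
IsMOBFS λ0 λ1 F =
  (∀ x → IsBFS λ0 λ1 (F x)) × (∀ x y → ¬ (x ≡ y) → OrthogonalBFS λ1 (F x) (F y))

{-# OPTIONS --safe #-}
-- Each R_i has n blocks, at most one in each of the n columns C_j, so every cell
-- R_i ∩ C_j is a single block B_{i,j}.  Hence row i of F_x counts the blocks of R_i
-- through x.  A point lies in λ₁n blocks and an equipartition into n parts spreads
-- them evenly, so this count is λ₁ (columns likewise).  In the same way the cells of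
-- row i where F_x and F_y are both 1 are the blocks of R_i through x and y; summed
-- over all rows they are the λ₁² blocks through the pair {x, y}.
module Submission where

open import Defs
open import Data.Nat using (ℕ; zero; suc; _+_; _*_; _∸_; _≤_; z≤n; s≤s; s≤s⁻¹; NonZero)
open import Data.Nat.Properties
  using (*-cancelʳ-≡; *-comm; m+n∸m≡n; m≤n+m; ≤-trans; suc-injective; +-identityʳ; 1+n≰n; +-suc;
         +-commutativeSemigroup)
open import Algebra.Properties.CommutativeSemigroup +-commutativeSemigroup using (interchange)
open import Data.Fin using (Fin; zero; suc; _≟_)
import Data.Fin.Properties as Finₚ
open import Data.Bool using (Bool; true; false; _∧_; if_then_else_; not)
open import Data.Bool.Properties using (∧-conicalˡ; ∧-conicalʳ; ∧-comm; ¬-not)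
open import Data.Product using (_×_; Σ; _,_; proj₁; proj₂; swap)
open import Function using (_∘_)
open import Relation.Nullary using (yes; no; contradiction)
open import Relation.Nullary.Decidable using (⌊⌋-map′)
open import Relation.Binary.PropositionalEquality
  using (_≡_; _≢_; refl; sym; trans; cong; cong₂; subst)
open Relation.Binary.PropositionalEquality.≡-Reasoning

==⇒≡ : ∀ {n} {a b : Fin n} → (a == b) ≡ true → a ≡ b
==⇒≡ {a = a} {b} with a ≟ b
... | yes a≡b = λ _ → a≡b
... | no _    = λ ()

≡⇒== : ∀ {n} {a b : Fin n} → a ≡ b → (a == b) ≡ true
≡⇒== {a = a} refl with a ≟ a
... | yes _   = refl
... | no a≢a = contradiction refl a≢a

==-suc : ∀ {n} (a b : Fin n) → (suc a == suc b) ≡ (a == b)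
==-suc a b = ⌊⌋-map′ (cong suc) Finₚ.suc-injective (a ≟ b)

indicator : Bool → ℕ
indicator b = if b then 1 else 0

sumFin-cong : ∀ n {f g : Fin n → ℕ} → (∀ i → f i ≡ g i) → sumFin n f ≡ sumFin n g
sumFin-cong zero    f≗g = refl
sumFin-cong (suc n) f≗g = cong₂ _+_ (f≗g zero) (sumFin-cong n (f≗g ∘ suc))

sumFin-zero : ∀ n → sumFin n (λ _ → 0) ≡ 0
sumFin-zero zero    = refl
sumFin-zero (suc n) = sumFin-zero n

sumFin-const : ∀ n c → sumFin n (λ _ → c) ≡ n * c
sumFin-const zero    c = refl
sumFin-const (suc n) c = cong (c +_) (sumFin-const n c)

sumFin-+ : ∀ n (f g : Fin n → ℕ) → sumFin n (λ i → f i + g i) ≡ sumFin n f + sumFin n g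
sumFin-+ zero    f g = refl
sumFin-+ (suc n) f g = trans (cong (f zero + g zero +_) (sumFin-+ n (f ∘ suc) (g ∘ suc)))
                             (interchange (f zero) (g zero) _ _)

sumFin-indicator-== : ∀ {n} (c : Fin n) (b : Bool) → sumFin n (λ i → indicator ((c == i) ∧ b)) ≡ indicator b
sumFin-indicator-== {suc n} zero    b = trans (cong (indicator b +_) (sumFin-zero n)) (+-identityʳ _)
sumFin-indicator-== {suc n} (suc c) b =
  trans (sumFin-cong n (λ i → cong (λ e → indicator (e ∧ b)) (==-suc c i))) (sumFin-indicator-== c b)

sumFin-≤ : ∀ n (f : Fin n → ℕ) → (∀ i → f i ≤ 1) → sumFin n f ≤ n
sumFin-≤ zero    f f≤1 = z≤n
sumFin-≤ (suc n) f f≤1 with f zero | f≤1 zero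
... | zero   | _       = ≤-trans (sumFin-≤ n (f ∘ suc) (f≤1 ∘ suc)) (m≤n+m n 1)
... | suc _  | s≤s z≤n = s≤s (sumFin-≤ n (f ∘ suc) (f≤1 ∘ suc))

sumFin≡n⇒≡1 : ∀ n (f : Fin n → ℕ) → (∀ i → f i ≤ 1) → sumFin n f ≡ n → ∀ i → f i ≡ 1
sumFin≡n⇒≡1 (suc n) f f≤1 sum≡ zero with f zero | f≤1 zero
... | zero     | _ = contradiction (subst (_≤ n) sum≡ (sumFin-≤ n (f ∘ suc) (f≤1 ∘ suc))) 1+n≰n
... | suc zero | _ = refl
... | suc (suc _) | s≤s ()
sumFin≡n⇒≡1 (suc n) f f≤1 sum≡ (suc i) =
  sumFin≡n⇒≡1 n (f ∘ suc) (f≤1 ∘ suc) (suc-injective (trans (cong (_+ sumFin n (f ∘ suc)) (sym f₀≡1)) sum≡)) i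
  where
  f₀≡1 : f zero ≡ 1
  f₀≡1 = sumFin≡n⇒≡1 (suc n) f f≤1 sum≡ zero

count-cong : ∀ {m} {p q : Fin m → Bool} → (∀ i → p i ≡ q i) → count p ≡ count q
count-cong {zero}  p≗q = refl
count-cong {suc m} p≗q = cong₂ _+_ (cong indicator (p≗q zero)) (count-cong (p≗q ∘ suc))

count≡sumFin : ∀ {m} (p : Fin m → Bool) → count p ≡ sumFin m (indicator ∘ p)
count≡sumFin {zero}  p = refl
count≡sumFin {suc m} p = cong (indicator (p zero) +_) (count≡sumFin (p ∘ suc))

count-fibres : ∀ {m n} (P : Fin m → Fin n) (p : Fin m → Bool) →
  count p ≡ sumFin n (λ i → count (λ b → (P b == i) ∧ p b))
count-fibres {zero}  {n} P p = sym (sumFin-zero n)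
count-fibres {suc m} {n} P p = begin
  indicator (p zero) + count (p ∘ suc)
    ≡⟨ cong₂ _+_ (sym (sumFin-indicator-== (P zero) (p zero))) (count-fibres (P ∘ suc) (p ∘ suc)) ⟩
  sumFin n (λ i → indicator ((P zero == i) ∧ p zero))
    + sumFin n (λ i → count (λ b → (P (suc b) == i) ∧ p (suc b)))
    ≡⟨ sym (sumFin-+ n _ _) ⟩
  sumFin n (λ i → count (λ b → (P b == i) ∧ p b)) ∎

count-not+count : ∀ {m} (p : Fin m → Bool) → count p + count (not ∘ p) ≡ m
count-not+count {zero}  p = refl
count-not+count {suc m} p with p zero
... | true  = cong suc (count-not+count (p ∘ suc))
... | false = trans (+-suc _ _) (cong suc (count-not+count (p ∘ suc)))

count-not : ∀ {m} (p : Fin m → Bool) → count (not ∘ p) ≡ m ∸ count p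
count-not {m} p = trans (sym (m+n∸m≡n (count p) _)) (cong (_∸ count p) (count-not+count p))

count-none : ∀ {m} {p : Fin m → Bool} → (∀ b → p b ≢ true) → count p ≡ 0
count-none {zero}      none = refl
count-none {suc m} {p} none rewrite ¬-not (none zero) = count-none (none ∘ suc)

count-singleSupport : ∀ {m} {p : Fin m → Bool} (c : Fin m) →
  (∀ b → p b ≡ true → b ≡ c) → count p ≡ indicator (p c)
count-singleSupport {suc m} {p} zero supp =
  trans (cong (indicator (p zero) +_) (count-none λ b pb → Finₚ.0≢1+n (sym (supp (suc b) pb))))
        (+-identityʳ _)
count-singleSupport {suc m} {p} (suc c) supp
  rewrite ¬-not {p zero} {true} (λ p₀ → Finₚ.0≢1+n (supp zero p₀)) =
  count-singleSupport c (λ b pb → Finₚ.suc-injective (supp (suc b) pb))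

count-positive : ∀ {m} {p : Fin m → Bool} {a} → p a ≡ true → 1 ≤ count p
count-positive {suc m} {p} {zero}  pa rewrite pa = s≤s z≤n
count-positive {suc m} {p} {suc a} pa = ≤-trans (count-positive {p = p ∘ suc} pa) (m≤n+m _ _)

count≤1⇒unique : ∀ {m} (p : Fin m → Bool) → count p ≤ 1 →
  ∀ {a b} → p a ≡ true → p b ≡ true → a ≡ b
count≤1⇒unique {suc m} p count≤1 {zero} {zero} pa pb = refl
count≤1⇒unique {suc m} p count≤1 {zero} {suc b} pa pb rewrite pa =
  contradiction (≤-trans (count-positive {p = p ∘ suc} pb) (s≤s⁻¹ count≤1)) λ ()
count≤1⇒unique {suc m} p count≤1 {suc a} {zero} pa pb rewrite pb =
  contradiction (≤-trans (count-positive {p = p ∘ suc} pa) (s≤s⁻¹ count≤1)) λ ()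
count≤1⇒unique {suc m} p count≤1 {suc a} {suc b} pa pb =
  cong suc (count≤1⇒unique (p ∘ suc) (≤-trans (m≤n+m _ _) count≤1) pa pb)

count-witness : ∀ {m} (p : Fin m → Bool) → 1 ≤ count p → Σ (Fin m) (λ b → p b ≡ true)
count-witness {suc m} p 1≤count with p zero in p₀
... | true  = zero , p₀
... | false = let b , pb = count-witness (p ∘ suc) 1≤count in suc b , pb

equipartition-count : ∀ {k m n} (B : Design k m) (P : Partition m n) (λ1 : ℕ) .{{_ : NonZero n}} →
  IsEquipartition B P → ∀ {x} → count (λ b → B b x) ≡ λ1 * n →
  ∀ i → count (λ b → (P b == i) ∧ B b x) ≡ λ1
equipartition-count {n = n} B P λ1 equi {x} reps i = *-cancelʳ-≡ partCount λ1 n (begin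
  partCount * n                                  ≡⟨ *-comm partCount n ⟩
  n * partCount                                  ≡⟨ sym (sumFin-const n partCount) ⟩
  sumFin n (λ _ → partCount)                     ≡⟨ sumFin-cong n (λ i′ → equi x i′ i) ⟨
  sumFin n (λ i′ → count (λ b → (P b == i′) ∧ B b x)) ≡⟨ count-fibres P _ ⟨
  count (λ b → B b x)                            ≡⟨ reps ⟩
  λ1 * n                                         ∎)
  where
  partCount : ℕ
  partCount = count (λ b → (P b == i) ∧ B b x)

orthogonal-sym : ∀ {m n₁ n₂} (P : Partition m n₁) (Q : Partition m n₂) → Orthogonal P Q → Orthogonal Q P
orthogonal-sym P Q orth j i = subst (_≤ 1) (count-cong λ b → ∧-comm (P b == i) (Q b == j)) (orth i j)

IsCellSelector : ∀ {m n} → Partition m n → Partition m n → (Fin n → Fin n → Fin m) → Set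
IsCellSelector R C Bij = ∀ i j → (R (Bij i j) ≡ i) × (C (Bij i j) ≡ j)

cellSelector : ∀ {m n} (R C : Partition m n) → HasTypeNN R → Orthogonal R C →
  Σ (Fin n → Fin n → Fin m) (IsCellSelector R C)
cellSelector {m} {n} R C typeR orth = (λ i j → proj₁ (cell i j)) , inCell
  where
  cellSize : Fin n → Fin n → ℕ
  cellSize i j = count (λ b → (C b == j) ∧ (R b == i))

  cellSize≡1 : ∀ i j → cellSize i j ≡ 1
  cellSize≡1 i = sumFin≡n⇒≡1 n (cellSize i) (λ j → orthogonal-sym R C orth j i)
                   (trans (sym (count-fibres C (λ b → R b == i))) (typeR i))

  cell : ∀ i j → Σ (Fin m) λ b → (C b == j) ∧ (R b == i) ≡ true
  cell i j = count-witness _ (subst (1 ≤_) (sym (cellSize≡1 i j)) (s≤s z≤n))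

  inCell : IsCellSelector R C (λ i j → proj₁ (cell i j))
  inCell i j = let cb = proj₂ (cell i j) in
    ==⇒≡ (∧-conicalʳ _ _ cb) , ==⇒≡ (∧-conicalˡ _ _ cb)

module CellCounting {m n} (R C : Partition m n) (orth : Orthogonal R C)
         {Bij : Fin n → Fin n → Fin m} (sel : IsCellSelector R C Bij) where

  cell-unique : ∀ {b i j} → R b ≡ i → C b ≡ j → b ≡ Bij i j
  cell-unique {i = i} {j} Rb Cb = count≤1⇒unique _ (orth i j)
    (cong₂ _∧_ (≡⇒== Rb) (≡⇒== Cb))
    (cong₂ _∧_ (≡⇒== (proj₁ (sel i j))) (≡⇒== (proj₂ (sel i j))))

  count-cell : ∀ i j (p : Fin m → Bool) →
    count (λ b → (C b == j) ∧ ((R b == i) ∧ p b)) ≡ indicator (p (Bij i j))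
  count-cell i j p = trans (count-singleSupport (Bij i j) inCell)
    (cong₂ (λ c r → indicator (c ∧ (r ∧ p (Bij i j)))) (≡⇒== (proj₂ (sel i j))) (≡⇒== (proj₁ (sel i j))))
    where
    inCell : ∀ b → (C b == j) ∧ ((R b == i) ∧ p b) ≡ true → b ≡ Bij i j
    inCell b hb = cell-unique (==⇒≡ (∧-conicalˡ _ _ inRow)) (==⇒≡ (∧-conicalˡ _ _ hb))
      where
      inRow : (R b == i) ∧ p b ≡ true
      inRow = ∧-conicalʳ (C b == j) _ hb

  count-row : ∀ i (p : Fin m → Bool) → count (λ j → p (Bij i j)) ≡ count (λ b → (R b == i) ∧ p b)
  count-row i p = begin
    count (λ j → p (Bij i j))                                         ≡⟨ count≡sumFin (λ j → p (Bij i j)) ⟩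
    sumFin n (λ j → indicator (p (Bij i j)))                           ≡⟨ sumFin-cong n (λ j → count-cell i j p) ⟨
    sumFin n (λ j → count (λ b → (C b == j) ∧ ((R b == i) ∧ p b)))     ≡⟨ count-fibres C _ ⟨
    count (λ b → (R b == i) ∧ p b)                                    ∎

count-column : ∀ {m n} (R C : Partition m n) → Orthogonal R C →
  ∀ {Bij} → IsCellSelector R C Bij →
  ∀ j (p : Fin m → Bool) → count (λ i → p (Bij i j)) ≡ count (λ b → (C b == j) ∧ p b)
count-column R C orth sel =
  CellCounting.count-row C R (orthogonal-sym R C orth) (λ j i → swap (sel i j))

incidenceSquare : ∀ {k m n} → Design k m → (Fin n → Fin n → Fin m) → Fin k → Square n
incidenceSquare B Bij x i j = B (Bij i j) x

module IncidenceSquares {k m n} (B : Design k m) (R C : Partition m n) (orth : Orthogonal R C)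
                        {Bij : Fin n → Fin n → Fin m} (sel : IsCellSelector R C Bij) where

  open CellCounting R C orth sel

  incidenceSquare-isBFS : (λ1 : ℕ) .{{_ : NonZero n}} → IsEquipartition B R → IsEquipartition B C →
    (∀ x → count (λ b → B b x) ≡ λ1 * n) → ∀ x → IsBFS (n ∸ λ1) λ1 (incidenceSquare B Bij x)
  incidenceSquare-isBFS λ1 equiR equiC reps x = record
    { rowOnes  = rowOnes
    ; rowZeros = λ i → trans (count-not (λ j → B (Bij i j) x)) (cong (n ∸_) (rowOnes i))
    ; colOnes  = colOnes
    ; colZeros = λ j → trans (count-not (λ i → B (Bij i j) x)) (cong (n ∸_) (colOnes j))
    }
    where
    rowOnes : ∀ i → count (λ j → B (Bij i j) x) ≡ λ1
    rowOnes i = trans (count-row i (λ b → B b x)) (equipartition-count B R λ1 equiR (reps x) i)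

    colOnes : ∀ j → count (λ i → B (Bij i j) x) ≡ λ1
    colOnes j = trans (count-column R C orth sel j (λ b → B b x))
                      (equipartition-count B C λ1 equiC (reps x) j)

  bothOnes-incidenceSquare : ∀ x y →
    bothOnes (incidenceSquare B Bij x) (incidenceSquare B Bij y) ≡ count (λ b → B b x ∧ B b y)
  bothOnes-incidenceSquare x y =
    trans (sumFin-cong n (λ i → count-row i (λ b → B b x ∧ B b y))) (sym (count-fibres R _))

theorem3p3 : (λ1 n k : ℕ) → NonZero λ1 → NonZero n →
    (B : Design k (n * n)) → IsDK (λ1 * n) (λ1 * λ1) B →
    (R C : Partition (n * n) n) →
    IsEquipartition B R → IsEquipartition B C →
    HasTypeNN R → HasTypeNN C → Orthogonal R C →
    (Σ (Fin n → Fin n → Fin (n * n)) λ Bij → ∀ i j → (R (Bij i j) ≡ i) × (C (Bij i j) ≡ j))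
    × ((Bij : Fin n → Fin n → Fin (n * n)) →
       (∀ i j → (R (Bij i j) ≡ i) × (C (Bij i j) ≡ j)) →
       IsMOBFS (n ∸ λ1) λ1 (λ x i j → B (Bij i j) x))
theorem3p3 λ1 n k _ nonZero B dk R C equiR equiC typeR _ orth = cellSelector R C typeR orth , mobfs
  where
  open IsDK dk

  mobfs : (Bij : Fin n → Fin n → Fin (n * n)) → IsCellSelector R C Bij →
          IsMOBFS (n ∸ λ1) λ1 (incidenceSquare B Bij)
  mobfs Bij sel =
    incidenceSquare-isBFS λ1 {{nonZero}} equiR equiC reps ,
    λ x y x≢y → trans (bothOnes-incidenceSquare x y) (pairs x y x≢y)
    where open IncidenceSquares B R C orth sel
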